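{- Let $\alpha\in(0,1)$ be irrational, let $n\ge1$ and $M\ge0$, and assume $n^{[\le M-1]}>0$ and $n^{[\ge M]}>0$. If $T$ is an integer with $q_{T-2}\ge n$, then $k_{\ge M}(n)\equiv k_{\ge M}(q_T-n)\pmod 2$.
   Context: Let $\alpha=[0;a_1,a_2,\dots]$, $q_0=1$, $q_1=a_1$, $q_{k+1}=a_{k+1}q_k+q_{k-1}$. Every positive integer $n$ has a unique Ostrowski representation $n=\sum_{k=0}^N b_kq_k$ with $0\le b_0\le a_1-1$, $0\le b_k\le a_{k+1}$ ($k\ge1$), and $b_{k-1}=0$ whenever $b_k=a_{k+1}$; $b_k(n)$ denotes $b_k$ (zero for $k>N$). For $M\ge0$: $n^{[\le M]}:=\sum_{k=0}^{\min\{M,N\}}b_kq_k$ (and $n^{[\le -1]}=0$), $n^{[\ge M]}:=\sum_{k=M}^N b_kq_k$, and $k_{\ge M}(n):=\min\{k\ge M: b_k(n)>0\}$. -}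

module Defs where

open import Data.Nat using (ℕ; zero; suc; _+_; _*_; _∸_; _≤_; _<_)
open import Data.List using (List; []; _∷_; take; drop)
open import Data.Product using (_×_)
open import Relation.Binary.PropositionalEquality using (_≡_)

-- The irrational α = [0; a 1, a 2, ...] ∈ (0,1) is encoded by its sequence
-- of partial quotients a : ℕ → ℕ (a 0 is unused), with a (suc i) ≥ 1.

q : (ℕ → ℕ) → ℕ → ℕ
q a zero = 1
q a (suc zero) = a 1
q a (suc (suc k)) = a (suc (suc k)) * q a (suc k) + q a k

digit : List ℕ → ℕ → ℕ
digit [] _ = 0
digit (b ∷ bs) zero = b
digit (b ∷ bs) (suc k) = digit bs k

valueFrom : (ℕ → ℕ) → ℕ → List ℕ → ℕ
valueFrom a k [] = 0
valueFrom a k (b ∷ bs) = b * q a k + valueFrom a (suc k) bs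

value : (ℕ → ℕ) → List ℕ → ℕ
value a bs = valueFrom a 0 bs

-- n^{[≤ M-1]} = Σ_{k=0}^{M-1} b_k q_k   (equal to 0 when M = 0)
lowPart : (ℕ → ℕ) → ℕ → List ℕ → ℕ
lowPart a M bs = valueFrom a 0 (take M bs)

highPart : (ℕ → ℕ) → ℕ → List ℕ → ℕ
highPart a M bs = valueFrom a M (drop M bs)

record IsOstrowski (a : ℕ → ℕ) (bs : List ℕ) : Set where
  field
    digit0   : digit bs 0 < a 1
    digitLe  : ∀ k → digit bs (suc k) ≤ a (suc (suc k))
    digitMax : ∀ k → digit bs (suc k) ≡ a (suc (suc k)) → digit bs k ≡ 0

IsOstRep : (ℕ → ℕ) → List ℕ → ℕ → Set
IsOstRep a bs n = IsOstrowski a bs × value a bs ≡ n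

IsKge : ℕ → List ℕ → ℕ → Set
IsKge M bs k = (M ≤ k) × (0 < digit bs k) × (∀ j → M ≤ j → j < k → digit bs j ≡ 0)

-- Write m = q_T − n and A_i = n^{[≤ i]} + m^{[≤ i]}.  Every prefix of an Ostrowski
-- representation is below the next q, and A_{T−1} = q_T.  Using
-- q_{i+2} = a_{i+2} q_{i+1} + q_i, descending induction gives A_i = β_i q_i + e_i q_{i+1}
-- with carries β_i, e_i ∈ {0,1}, and uniqueness of this representation forces
-- β_i = e_{i+1} and e_i + b_{i+1} + c_{i+1} = β_{i+1} + e_{i+1} a_{i+2}.  Let
-- K = k_{≥M}(n) ≤ K′ = k_{≥M}(m).  At level K − 1 the carry β is 1, and as long as m
-- has no digit the carries run through (1,∗) → (0,1) → (1,0), the second step having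
-- digit sum 0.  So the first digit of m lies an even number of places after K.
-- The hypothesis n ≤ q_{T−2} only serves to give n ≤ m, so that k_{≥M}(m) exists.
module Submission where

open import Defs
open import Data.Nat using (ℕ; zero; suc; _+_; _*_; _∸_; _≤_; _<_; _%_; z≤n; s≤s; NonZero; >-nonZero; _≤′_; ≤′-refl; ≤′-step)
open import Data.Nat.Properties
open import Data.Nat.DivMod using (_/_; [m+kn]%n≡m%n; m<n⇒m%n≡m; m≡m%n+[m/n]*n; m<n*o⇒m/o<n)
open import Data.Nat.Tactic.RingSolver using (solve-∀)
open import Data.Fin using (Fin; toℕ; fromℕ<)
open import Data.Fin.Patterns using (0F; 1F)
open import Data.Fin.Properties using (toℕ-injective; toℕ-fromℕ<)
open import Data.List using (List; []; _∷_; take; drop)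
open import Data.Product using (Σ; ∃; ∃₂; _×_; _,_; proj₁; proj₂; map₂)
open import Data.Sum using (inj₁; inj₂; [_,_]′)
open import Data.Empty using (⊥-elim)
open import Relation.Binary.PropositionalEquality using (_≡_; refl; sym; trans; cong; cong₂; subst; module ≡-Reasoning)

step-≤⇒mono : (f : ℕ → ℕ) → (∀ j → f j ≤ f (suc j)) → ∀ {i j} → i ≤ j → f i ≤ f j
step-≤⇒mono f step i≤j = go (≤⇒≤′ i≤j)
  where
  go : ∀ {i j} → i ≤′ j → f i ≤ f j
  go ≤′-refl = ≤-refl
  go (≤′-step i≤′j) = ≤-trans (go i≤′j) (step _)

module _ {m n r k l : ℕ} .{{_ : NonZero n}} (r<n : r < n) (eq : m + k * n ≡ r + l * n) where

  m+kn≡r+ln⇒m%n≡r : m % n ≡ r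
  m+kn≡r+ln⇒m%n≡r = begin
    m % n            ≡⟨ sym ([m+kn]%n≡m%n m k n) ⟩
    (m + k * n) % n  ≡⟨ cong (_% n) eq ⟩
    (r + l * n) % n  ≡⟨ [m+kn]%n≡m%n r l n ⟩
    r % n            ≡⟨ m<n⇒m%n≡m r<n ⟩
    r                ∎
    where open ≡-Reasoning

  m+kn≡r+ln⇒m≡r×k≡l : m < n → m ≡ r × k ≡ l
  m+kn≡r+ln⇒m≡r×k≡l m<n =
    m≡r , *-cancelʳ-≡ k l n (+-cancelˡ-≡ m _ _ (trans eq (cong (_+ l * n) (sym m≡r))))
    where
    m≡r : m ≡ r
    m≡r = trans (sym (m<n⇒m%n≡m m<n)) m+kn≡r+ln⇒m%n≡r

bit*m≤m : (β : Fin 2) (m : ℕ) → toℕ β * m ≤ m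
bit*m≤m 0F m = z≤n
bit*m≤m 1F m = ≤-reflexive (+-identityʳ m)

module OstrowskiDigits (a : ℕ → ℕ) where

  valueFrom-take-suc : ∀ k j l → valueFrom a k (take (suc j) l) ≡ valueFrom a k (take j l) + digit l j * q a (k + j)
  valueFrom-take-suc k zero [] = refl
  valueFrom-take-suc k (suc j) [] = refl
  valueFrom-take-suc k zero (b ∷ l) = trans (+-identityʳ _) (cong (λ i → b * q a i) (sym (+-identityʳ k)))
  valueFrom-take-suc k (suc j) (b ∷ l) rewrite valueFrom-take-suc (suc k) j l | +-suc k j =
    sym (+-assoc (b * q a k) _ _)

  valueFrom-take-drop : ∀ k j l → valueFrom a k l ≡ valueFrom a k (take j l) + valueFrom a (k + j) (drop j l)
  valueFrom-take-drop k zero l = cong (λ i → valueFrom a i l) (sym (+-identityʳ k))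
  valueFrom-take-drop k (suc j) [] = refl
  valueFrom-take-drop k (suc j) (b ∷ l) rewrite valueFrom-take-drop (suc k) j l | +-suc k j =
    sym (+-assoc (b * q a k) _ _)

  lowPart-suc : ∀ j l → lowPart a (suc j) l ≡ lowPart a j l + digit l j * q a j
  lowPart-suc j l = valueFrom-take-suc 0 j l

  lowPart-mono : ∀ {l i j} → i ≤ j → lowPart a i l ≤ lowPart a j l
  lowPart-mono {l} = step-≤⇒mono (λ j → lowPart a j l)
    (λ j → ≤-trans (m≤m+n _ _) (≤-reflexive (sym (lowPart-suc j l))))

  value≡lowPart+highPart : ∀ j l → value a l ≡ lowPart a j l + highPart a j l
  value≡lowPart+highPart j l = valueFrom-take-drop 0 j l

  lowPart<q : ∀ {l} → IsOstrowski a l → ∀ j → lowPart a j l < q a j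
  lowPart<q {l} o j = proj₁ (consecutive j)
    where
    open IsOstrowski o
    open ≤-Reasoning
    -- Two consecutive bounds are carried along because b_{j+1} = a_{j+2} forces b_j = 0.
    consecutive : ∀ j → lowPart a j l < q a j × lowPart a (suc j) l < q a (suc j)
    consecutive zero = s≤s z≤n , subst (_< a 1) (sym (trans (lowPart-suc 0 l) (*-identityʳ _))) digit0
    consecutive (suc j) with consecutive j
    ... | P₀<q₀ , P₁<q₁ with m≤n⇒m<n∨m≡n (digitLe j)
    ... | inj₁ d<a = P₁<q₁ , (begin-strict
      lowPart a (suc (suc j)) l                            ≡⟨ lowPart-suc (suc j) l ⟩
      lowPart a (suc j) l + digit l (suc j) * q a (suc j)  <⟨ +-monoˡ-< _ P₁<q₁ ⟩
      suc (digit l (suc j)) * q a (suc j)                  ≤⟨ *-monoˡ-≤ (q a (suc j)) d<a ⟩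
      a (suc (suc j)) * q a (suc j)                        ≤⟨ m≤m+n _ _ ⟩
      q a (suc (suc j))                                    ∎)
    ... | inj₂ d≡a = P₁<q₁ , (begin-strict
      lowPart a (suc (suc j)) l                            ≡⟨ lowPart-suc (suc j) l ⟩
      lowPart a (suc j) l + digit l (suc j) * q a (suc j)  <⟨ +-monoˡ-< _ P₁<q₀ ⟩
      q a j + digit l (suc j) * q a (suc j)                ≡⟨ +-comm (q a j) _ ⟩
      digit l (suc j) * q a (suc j) + q a j                ≡⟨ cong (λ d → d * q a (suc j) + q a j) d≡a ⟩
      q a (suc (suc j))                                    ∎)
      where
      P₁<q₀ : lowPart a (suc j) l < q a j
      P₁<q₀ = begin-strict
        lowPart a (suc j) l                ≡⟨ lowPart-suc j l ⟩
        lowPart a j l + digit l j * q a j  ≡⟨ cong (λ d → lowPart a j l + d * q a j) (digitMax j d≡a) ⟩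
        lowPart a j l + 0                  ≡⟨ +-identityʳ _ ⟩
        lowPart a j l                      <⟨ P₀<q₀ ⟩
        q a j                              ∎

  q≤value⇒highPart-pos : ∀ {l j} → IsOstrowski a l → q a j ≤ value a l → 0 < highPart a j l
  q≤value⇒highPart-pos {l} {j} o q≤v = n≢0⇒n>0 λ high≡0 → <⇒≱ (lowPart<q o j) (begin
    q a j                                ≤⟨ q≤v ⟩
    value a l                            ≡⟨ value≡lowPart+highPart j l ⟩
    lowPart a j l + highPart a j l       ≡⟨ cong (lowPart a j l +_) high≡0 ⟩
    lowPart a j l + 0                    ≡⟨ +-identityʳ _ ⟩
    lowPart a j l                        ∎)
    where open ≤-Reasoning

  -- The offset k is irrelevant to positivity; highPart a M l is the case k = M.
  first-nonzero-digit : ∀ {k} M l → 0 < valueFrom a k (drop M l) → Σ ℕ (IsKge M l)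
  first-nonzero-digit zero [] ()
  first-nonzero-digit zero (suc b ∷ l) _ = 0 , z≤n , s≤s z≤n , λ _ _ ()
  first-nonzero-digit zero (zero ∷ l) pos with first-nonzero-digit zero l pos
  ... | K , _ , K-pos , below-zero = suc K , z≤n , K-pos , λ where
    zero _ _ → refl
    (suc j) _ (s≤s j<K) → below-zero j z≤n j<K
  first-nonzero-digit (suc M) [] ()
  first-nonzero-digit (suc M) (b ∷ l) pos with first-nonzero-digit M l pos
  ... | K , M≤K , K-pos , below-zero = suc K , s≤s M≤K , K-pos , λ where
    (suc j) (s≤s M≤j) (s≤s j<K) → below-zero j M≤j j<K

  -- n^{[≤ i]} + m^{[≤ i]}; note that lowPart a j is the paper's n^{[≤ j−1]}.
  lowSum : List ℕ → List ℕ → ℕ → ℕ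
  lowSum f g i = lowPart a (suc i) f + lowPart a (suc i) g

  digitSum : List ℕ → List ℕ → ℕ → ℕ
  digitSum f g j = digit f j + digit g j

  record CarryAt (f g : List ℕ) (i : ℕ) (β e : Fin 2) : Set where
    constructor carry
    field lowSum≡ : lowSum f g i ≡ toℕ β * q a i + toℕ e * q a (suc i)

  carry-comm : ∀ {f g i β e} → CarryAt f g i β e → CarryAt g f i β e
  carry-comm {f} {g} {i} (carry eq) = carry (trans (+-comm (lowPart a (suc i) g) (lowPart a (suc i) f)) eq)

  lowSum-suc : ∀ f g i → lowSum f g (suc i) ≡ lowSum f g i + digitSum f g (suc i) * q a (suc i)
  lowSum-suc f g i = trans (cong₂ _+_ (lowPart-suc (suc i) f) (lowPart-suc (suc i) g))
                           (regroup (lowPart a (suc i) f) (lowPart a (suc i) g) (digit f (suc i)) (digit g (suc i)) (q a (suc i)))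
    where
    regroup : ∀ x y u v w → x + u * w + (y + v * w) ≡ x + y + (u + v) * w
    regroup = solve-∀

  carry-recurrence : ∀ {f g i β e} → CarryAt f g (suc i) β e →
    lowSum f g i + digitSum f g (suc i) * q a (suc i) ≡ toℕ e * q a i + (toℕ β + toℕ e * a (suc (suc i))) * q a (suc i)
  carry-recurrence {f} {g} {i} {β} {e} (carry c) =
    trans (sym (lowSum-suc f g i)) (trans c (expand (toℕ β) (toℕ e) (a (suc (suc i))) (q a i) (q a (suc i))))
    where
    expand : ∀ x y u q₀ q₁ → x * q₁ + y * (u * q₁ + q₀) ≡ y * q₀ + (x + y * u) * q₁
    expand = solve-∀

  module _ (a-pos : ∀ i → 1 ≤ a (suc i)) where

    q+q≤q : ∀ i → q a i + q a (suc i) ≤ q a (suc (suc i))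
    q+q≤q i = ≤-trans (≤-reflexive (+-comm (q a i) _)) (+-monoˡ-≤ (q a i) (m≤n*m _ _ {{>-nonZero (a-pos (suc i))}}))

    q-mono : ∀ {i j} → i ≤ j → q a i ≤ q a j
    q-mono = step-≤⇒mono (q a) λ where
      zero → a-pos 0
      (suc i) → ≤-trans (m≤n+m _ _) (q+q≤q i)

    q-pos : ∀ j → 0 < q a j
    q-pos j = q-mono {0} {j} z≤n

    q-nonZero : ∀ j → NonZero (q a j)
    q-nonZero j = >-nonZero (q-pos j)

    q-cancel-< : ∀ {i j} → q a i < q a j → i < j
    q-cancel-< qi<qj = ≰⇒> λ j≤i → <⇒≱ qi<qj (q-mono j≤i)

    q-<-of-lowPart : ∀ {l i} → IsOstrowski a l → 0 < lowPart a (suc i) l → q a i < q a (suc i)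
    q-<-of-lowPart {i = zero} o pos = ≤-<-trans pos (lowPart<q o 1)
    q-<-of-lowPart {i = suc i} o _ = <-≤-trans (m<n+m (q a (suc i)) (q-pos i)) (q+q≤q i)

    valueFrom<q⇒≡0 : ∀ k l → valueFrom a k l < q a k → valueFrom a k l ≡ 0
    valueFrom<q⇒≡0 k [] _ = refl
    valueFrom<q⇒≡0 k (zero ∷ l) v<q = valueFrom<q⇒≡0 (suc k) l (<-≤-trans v<q (q-mono (n≤1+n k)))
    valueFrom<q⇒≡0 k (suc b ∷ l) v<q = ⊥-elim (<⇒≱ v<q (≤-trans (m≤m+n _ _) (m≤m+n _ _)))

    lowPart≡value : ∀ {l j} → value a l < q a j → lowPart a j l ≡ value a l
    lowPart≡value {l} {j} v<q = begin
      lowPart a j l                   ≡⟨ sym (+-identityʳ _) ⟩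
      lowPart a j l + 0               ≡⟨ cong (lowPart a j l +_) (sym high≡0) ⟩
      lowPart a j l + highPart a j l  ≡⟨ sym (value≡lowPart+highPart j l) ⟩
      value a l                       ∎
      where
      open ≡-Reasoning
      high≡0 : highPart a j l ≡ 0
      high≡0 = valueFrom<q⇒≡0 j (drop j l)
        (≤-<-trans (≤-trans (m≤n+m _ _) (≤-reflexive (sym (value≡lowPart+highPart j l)))) v<q)

    q≤value : ∀ {l K} → 0 < digit l K → q a K ≤ value a l
    q≤value {l} {K} pos = begin
      q a K                                       ≤⟨ m≤n*m (q a K) (digit l K) {{>-nonZero pos}} ⟩
      digit l K * q a K                           ≤⟨ m≤n+m _ _ ⟩
      lowPart a K l + digit l K * q a K           ≡⟨ sym (lowPart-suc K l) ⟩
      lowPart a (suc K) l                         ≤⟨ m≤m+n _ _ ⟩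
      lowPart a (suc K) l + highPart a (suc K) l  ≡⟨ sym (value≡lowPart+highPart (suc K) l) ⟩
      value a l                                   ∎
      where open ≤-Reasoning

    carry-step : ∀ {f g i β e β′ e′} → q a i < q a (suc i) → CarryAt f g i β e → CarryAt f g (suc i) β′ e′ →
      β ≡ e′ × toℕ e + digitSum f g (suc i) ≡ toℕ β′ + toℕ e′ * a (suc (suc i))
    carry-step {f} {g} {i} {β} {e} {β′} {e′} qᵢ<qᵢ₊₁ (carry c) c′ =
      toℕ-injective (*-cancelʳ-≡ (toℕ β) (toℕ e′) (q a i) {{q-nonZero i}} (proj₁ unique)) , proj₂ unique
      where
      s = digitSum f g (suc i)
      regroup : ∀ x y s Q → x + y * Q + s * Q ≡ x + (y + s) * Q
      regroup = solve-∀
      same-sum : toℕ β * q a i + (toℕ e + s) * q a (suc i) ≡ toℕ e′ * q a i + (toℕ β′ + toℕ e′ * a (suc (suc i))) * q a (suc i)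
      same-sum = trans (sym (regroup (toℕ β * q a i) (toℕ e) s (q a (suc i))))
                       (trans (cong (_+ s * q a (suc i)) (sym c)) (carry-recurrence c′))
      unique : toℕ β * q a i ≡ toℕ e′ * q a i × toℕ e + s ≡ toℕ β′ + toℕ e′ * a (suc (suc i))
      unique = m+kn≡r+ln⇒m≡r×k≡l {{q-nonZero (suc i)}} (≤-<-trans (bit*m≤m e′ _) qᵢ<qᵢ₊₁) same-sum
                                 (≤-<-trans (bit*m≤m β _) qᵢ<qᵢ₊₁)

    carry-below : ∀ {f g i β′ e′} → IsOstrowski a f → IsOstrowski a g → q a i < q a (suc i) →
      CarryAt f g (suc i) β′ e′ → ∃ λ ε → CarryAt f g i e′ ε
    carry-below {f} {g} {i} {β′} {e′} f-ost g-ost qᵢ<qᵢ₊₁ c′ = fromℕ< sum/Q<2 , carry (begin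
      lowSum f g i                               ≡⟨ m≡m%n+[m/n]*n (lowSum f g i) Q ⟩
      lowSum f g i % Q + lowSum f g i / Q * Q    ≡⟨ cong₂ _+_ sum%Q (cong (_* Q) (sym (toℕ-fromℕ< sum/Q<2))) ⟩
      toℕ e′ * q a i + toℕ (fromℕ< sum/Q<2) * Q  ∎)
      where
      open ≡-Reasoning
      Q = q a (suc i)
      instance
        Q-nonZero : NonZero Q
        Q-nonZero = q-nonZero (suc i)
      sum<2Q : lowSum f g i < 2 * Q
      sum<2Q = subst (lowSum f g i <_) (cong (Q +_) (sym (+-identityʳ Q)))
                     (+-mono-< (lowPart<q f-ost (suc i)) (lowPart<q g-ost (suc i)))
      sum/Q<2 : lowSum f g i / Q < 2
      sum/Q<2 = m<n*o⇒m/o<n sum<2Q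
      sum%Q : lowSum f g i % Q ≡ toℕ e′ * q a i
      sum%Q = m+kn≡r+ln⇒m%n≡r {k = digitSum f g (suc i)} {l = toℕ β′ + toℕ e′ * a (suc (suc i))}
                              (≤-<-trans (bit*m≤m e′ _) qᵢ<qᵢ₊₁) (carry-recurrence c′)

    carries-below : ∀ {f g L τ β e} → IsOstrowski a f → IsOstrowski a g → (∀ {i} → L ≤ i → q a i < q a (suc i)) →
      CarryAt f g τ β e → ∀ {i} → L ≤ i → i ≤ τ → ∃₂ (CarryAt f g i)
    carries-below f-ost g-ost q-< c L≤i i≤τ with m≤n⇒m<n∨m≡n i≤τ
    ... | inj₂ refl = _ , _ , c
    ... | inj₁ (s≤s i≤τ′) =
      carries-below f-ost g-ost q-< (proj₂ (carry-below f-ost g-ost (q-< (≤-trans L≤i i≤τ′)) c)) L≤i i≤τ′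

    carry-1∗⇒carry-01 : ∀ {f g i e} → IsOstrowski a f → IsOstrowski a g → q a i < q a (suc i) → digit g (suc i) ≡ 0 →
      CarryAt f g i 1F e → ∃₂ (CarryAt f g (suc i)) → CarryAt f g (suc i) 0F 1F
    carry-1∗⇒carry-01 f-ost g-ost qᵢ<qᵢ₊₁ g≡0 c (0F , e′ , c′) with carry-step qᵢ<qᵢ₊₁ c c′
    ... | refl , _ = c′
    carry-1∗⇒carry-01 {f} {g} {i} f-ost g-ost qᵢ<qᵢ₊₁ g≡0 c (1F , e′ , c′) with carry-step qᵢ<qᵢ₊₁ c c′
    ... | refl , _ = ⊥-elim (<⇒≢ (+-mono-< (lowPart<q f-ost (suc (suc i))) g-part<)
                                 (trans (CarryAt.lowSum≡ c′) (swap (q a (suc i)) _)))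
      where
      swap : ∀ x y → 1 * x + 1 * y ≡ y + x
      swap = solve-∀
      g-part< : lowPart a (suc (suc i)) g < q a (suc i)
      g-part< = begin-strict
        lowPart a (suc (suc i)) g                            ≡⟨ lowPart-suc (suc i) g ⟩
        lowPart a (suc i) g + digit g (suc i) * q a (suc i)  ≡⟨ cong (λ d → lowPart a (suc i) g + d * q a (suc i)) g≡0 ⟩
        lowPart a (suc i) g + 0                              ≡⟨ +-identityʳ _ ⟩
        lowPart a (suc i) g                                  <⟨ lowPart<q g-ost (suc i) ⟩
        q a (suc i)                                          ∎
        where open ≤-Reasoning

    carry-01⇒carry-10 : ∀ {f g i} → q a i < q a (suc i) → CarryAt f g i 0F 1F → ∃₂ (CarryAt f g (suc i)) →
      digitSum f g (suc i) ≡ 0 × CarryAt f g (suc i) 1F 0F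
    carry-01⇒carry-10 qᵢ<qᵢ₊₁ c (0F , e′ , c′) with carry-step qᵢ<qᵢ₊₁ c c′
    ... | refl , ()
    carry-01⇒carry-10 qᵢ<qᵢ₊₁ c (1F , e′ , c′) with carry-step qᵢ<qᵢ₊₁ c c′
    ... | refl , s+1≡1 = suc-injective s+1≡1 , c′

    top-carry : ∀ {f g τ} → value a f < q a (suc τ) → value a g < q a (suc τ) →
      value a f + value a g ≡ q a (suc τ) → CarryAt f g τ 0F 1F
    top-carry {f} {g} {τ} f<q g<q sum = carry (begin
      lowSum f g τ           ≡⟨ cong₂ _+_ (lowPart≡value {f} {suc τ} f<q) (lowPart≡value {g} {suc τ} g<q) ⟩
      value a f + value a g  ≡⟨ sum ⟩
      q a (suc τ)            ≡⟨ sym (+-identityʳ _) ⟩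
      q a (suc τ) + 0        ∎)
      where open ≡-Reasoning

    module CarryParity {f g : List ℕ} (f-ost : IsOstrowski a f) (g-ost : IsOstrowski a g) {L τ : ℕ}
      (q-< : ∀ {i} → L ≤ i → q a i < q a (suc i))
      (low : 0 < lowSum f g L)
      (carries : ∀ {i} → L ≤ i → i ≤ τ → ∃₂ (CarryAt f g i)) where

      leading-carry : ∀ {k} → L ≤ k → suc k ≤ τ → 0 < digit f (suc k) → ∃ λ e → CarryAt f g k 1F e
      leading-carry {k} L≤k k<τ f-pos with carries L≤k (<⇒≤ k<τ)
      ... | 1F , e , c = e , c
      ... | 0F , 0F , carry c = ⊥-elim (<⇒≢ low≤ (sym c))
        where
        low≤ : 0 < lowSum f g k
        low≤ = ≤-trans low (+-mono-≤ (lowPart-mono {f} (s≤s L≤k)) (lowPart-mono {g} (s≤s L≤k)))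
      ... | 0F , 1F , c = ⊥-elim (<⇒≢ f-pos (sym (m+n≡0⇒m≡0 _ digitSum≡0)))
        where
        digitSum≡0 : digitSum f g (suc k) ≡ 0
        digitSum≡0 = proj₁ (carry-01⇒carry-10 (q-< L≤k) c (carries (≤-trans L≤k (n≤1+n k)) k<τ))

      carry-skip : ∀ {k e} → L ≤ k → suc (suc k) ≤ τ → digit g (suc k) ≡ 0 → CarryAt f g k 1F e →
        digitSum f g (suc (suc k)) ≡ 0 × CarryAt f g (suc (suc k)) 1F 0F
      carry-skip {k} L≤k k+2≤τ g≡0 c =
        carry-01⇒carry-10 (q-< L≤k+1) (carry-1∗⇒carry-01 f-ost g-ost (q-< L≤k) g≡0 c (carries L≤k+1 (<⇒≤ k+2≤τ)))
                          (carries L≤k+2 k+2≤τ)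
        where
        L≤k+1 = ≤-trans L≤k (n≤1+n k)
        L≤k+2 = ≤-trans L≤k+1 (n≤1+n (suc k))

      -- suc (suc m) % 2 reduces to m % 2, so the recursive call has the required type.
      carry-chain : ∀ {k′} → 0 < digit g (suc k′) → suc k′ ≤ τ → ∀ d {k e} → d + k ≡ k′ → L ≤ k →
        CarryAt f g k 1F e → (∀ j → suc k ≤ j → j < suc k′ → digit g j ≡ 0) → suc k % 2 ≡ suc k′ % 2
      carry-chain _ _ zero refl _ _ _ = refl
      carry-chain g-pos k′<τ (suc zero) {k} refl L≤k c zeros =
        ⊥-elim (<⇒≢ g-pos (sym (m+n≡0⇒n≡0 _ (proj₁ (carry-skip L≤k k′<τ (zeros (suc k) ≤-refl ≤-refl) c)))))
      carry-chain g-pos k′<τ (suc (suc d)) {k} refl L≤k c zeros =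
        carry-chain g-pos k′<τ d (trans (+-suc d (suc k)) (cong suc (+-suc d k))) (≤-trans L≤k (m≤n+m k 2))
          (proj₂ (carry-skip L≤k (≤-trans k+2≤k′+1 k′<τ) (zeros (suc k) ≤-refl k+2≤k′+1) c))
          (λ j k+3≤j → zeros j (≤-trans (m≤n+m (suc k) 2) k+3≤j))
        where
        k+2≤k′+1 : suc (suc k) ≤ suc (suc (suc d) + k)
        k+2≤k′+1 = s≤s (s≤s (m≤n+m k (suc d)))

      carry-parity : ∀ {K K′} → IsKge (suc L) f K → IsKge (suc L) g K′ → K ≤ K′ → K′ ≤ τ → K % 2 ≡ K′ % 2
      carry-parity (s≤s L≤k , f-pos , _) (_ , g-pos , g-zeros) (s≤s k≤k′) k′<τ =
        let (e , c) = leading-carry L≤k (≤-trans (s≤s k≤k′) k′<τ) f-pos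
        in carry-chain g-pos k′<τ _ (m∸n+n≡m k≤k′) L≤k c (λ j k+1≤j → g-zeros j (≤-trans (s≤s L≤k) k+1≤j))

    complement-parity : ∀ {f g τ L K K′} → IsOstrowski a f → IsOstrowski a g → value a f + value a g ≡ q a (suc τ) →
      0 < lowPart a (suc L) f → IsKge (suc L) f K → IsKge (suc L) g K′ → K % 2 ≡ K′ % 2
    complement-parity {f} {g} {τ} {L} {K} {K′} f-ost g-ost sum low isK isK′ =
      [ (λ K≤K′ → CarryParity.carry-parity f-ost g-ost q-< low-sum carries isK isK′ K≤K′ K′≤τ)
      , (λ K′≤K → sym (CarryParity.carry-parity g-ost f-ost q-< low-sum′ carries′ isK′ isK K′≤K K≤τ))
      ]′ (≤-total K K′)
      where
      q[K]≤f : q a K ≤ value a f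
      q[K]≤f = q≤value {f} {K} (proj₁ (proj₂ isK))
      q[K′]≤g : q a K′ ≤ value a g
      q[K′]≤g = q≤value {g} {K′} (proj₁ (proj₂ isK′))
      f<q : value a f < q a (suc τ)
      f<q = subst (value a f <_) sum (m<m+n _ (<-≤-trans (q-pos K′) q[K′]≤g))
      g<q : value a g < q a (suc τ)
      g<q = subst (value a g <_) sum (m<n+m _ (<-≤-trans (q-pos K) q[K]≤f))
      K≤τ : K ≤ τ
      K≤τ = ≤-pred (q-cancel-< (≤-<-trans q[K]≤f f<q))
      K′≤τ : K′ ≤ τ
      K′≤τ = ≤-pred (q-cancel-< (≤-<-trans q[K′]≤g g<q))
      q-< : ∀ {i} → L ≤ i → q a i < q a (suc i)
      q-< L≤i = q-<-of-lowPart f-ost (≤-trans low (lowPart-mono {f} (s≤s L≤i)))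
      low-sum : 0 < lowSum f g L
      low-sum = ≤-trans low (m≤m+n _ _)
      low-sum′ : 0 < lowSum g f L
      low-sum′ = subst (0 <_) (+-comm (lowPart a (suc L) f) (lowPart a (suc L) g)) low-sum
      carries : ∀ {i} → L ≤ i → i ≤ τ → ∃₂ (CarryAt f g i)
      carries = carries-below f-ost g-ost q-< (top-carry f<q g<q sum)
      carries′ : ∀ {i} → L ≤ i → i ≤ τ → ∃₂ (CarryAt g f i)
      carries′ L≤i i≤τ = map₂ (map₂ carry-comm) (carries L≤i i≤τ)

lemma5p17 : (a : ℕ → ℕ) → (∀ i → 1 ≤ a (suc i)) →
    (n M t : ℕ) → 1 ≤ n →
    (bs cs : List ℕ) → IsOstRep a bs n → IsOstRep a cs (q a (t + 2) ∸ n) →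
    0 < lowPart a M bs → 0 < highPart a M bs →
    n ≤ q a t →
    Σ ℕ (λ k → Σ ℕ (λ k′ → IsKge M bs k × IsKge M cs k′ × (k % 2 ≡ k′ % 2)))
lemma5p17 a a-pos n zero t _ bs cs _ _ () _ _
-- The hypothesis 1 ≤ n is implied by 0 < highPart a M bs.
lemma5p17 a a-pos n (suc L) t _ bs cs (bs-ost , bs-val) (cs-ost , cs-val) low high n≤qt =
  let (K , isK) = first-nonzero-digit (suc L) bs high
      (K′ , isK′) = first-nonzero-digit (suc L) cs (q≤value⇒highPart-pos {cs} {suc L} cs-ost (q[M]≤m isK))
  in K , K′ , isK , isK′ , complement-parity a-pos {τ = suc t} bs-ost cs-ost sum low isK isK′
  where
  open OstrowskiDigits a
  open ≤-Reasoning
  m≡ : value a cs ≡ q a (suc (suc t)) ∸ n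
  m≡ = trans cs-val (cong (λ T → q a T ∸ n) (+-comm t 2))
  n≤m : n ≤ q a (suc (suc t)) ∸ n
  n≤m = m+n≤o⇒m≤o∸n n (≤-trans (+-mono-≤ n≤qt (≤-trans n≤qt (q-mono a-pos (n≤1+n t)))) (q+q≤q a-pos t))
  sum : value a bs + value a cs ≡ q a (suc (suc t))
  sum = trans (cong₂ _+_ bs-val m≡) (m+[n∸m]≡n (≤-trans n≤m (m∸n≤m _ n)))
  q[M]≤m : ∀ {K} → IsKge (suc L) bs K → q a (suc L) ≤ value a cs
  q[M]≤m {K} (M≤K , K-pos , _) = begin
    q a (suc L)                ≤⟨ q-mono a-pos M≤K ⟩
    q a K                      ≤⟨ q≤value a-pos {bs} {K} K-pos ⟩
    value a bs                 ≡⟨ bs-val ⟩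
    n                          ≤⟨ n≤m ⟩
    q a (suc (suc t)) ∸ n      ≡⟨ sym m≡ ⟩
    value a cs                 ∎
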